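{- For every $n\ge 1$, the complete graph $K_n$ is not a square.
   Context: All graphs are finite and simple. A partially labeled graph is a graph $H$ together with an injective map $\theta: L\to V(H)$, $L\subseteq\mathbb{N}$, whose image $\theta(L)$ is nonempty and a proper subset of $V(H)$; vertices in $\theta(L)$ are labeled. The square $HH$ is obtained from two disjoint copies of $H$ by identifying each labeled vertex $\theta(\ell)$ of the first copy with $\theta(\ell)$ of the second copy (keeping all edges, merging double edges). A graph $G$ is a square if $G\cong HH$ for some partially labeled graph $H$. -}

module Defs where

open import Data.Nat using (ℕ; _≤_)
open import Data.Fin using (Fin; _≟_)
open import Data.Bool using (Bool; true; false; not; T)
open import Data.Product using (Σ; ∃; _×_; _,_)
open import Data.Sum using (_⊎_; inj₁; inj₂)
open import Relation.Nullary using (¬_; yes; no)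
open import Relation.Nullary.Decidable using (⌊_⌋)
open import Relation.Binary.PropositionalEquality using (_≡_; _≢_; refl; sym)
open import Function.Definitions using (Injective; Bijective)
open import Function.Bundles using (_⇔_)

record Graph : Set where
  field
    n      : ℕ
    adj    : Fin n → Fin n → Bool
    adj-sym     : ∀ u v → adj u v ≡ adj v u
    adj-irrefl  : ∀ v → adj v v ≡ false
open Graph public

-- A partially labeled graph: a graph H with an injective labeling
-- θ : L → V(H), where the label set L is (w.l.o.g., being finite since θ is
-- injective into a finite set) represented as Fin k; the image of θ is
-- nonempty (1 ≤ k) and a proper subset of V(H).
record PLGraph : Set where
  field
    H        : Graph
    k        : ℕ
    θ        : Fin k → Fin (n H)
    θ-inj    : Injective _≡_ _≡_ θ
    nonempty : 1 ≤ k
    proper   : ∃ λ (v : Fin (n H)) → ∀ (ℓ : Fin k) → θ ℓ ≢ v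
open PLGraph public

Labeled : (P : PLGraph) → Fin (n (H P)) → Set
Labeled P v = ∃ λ ℓ → θ P ℓ ≡ v

-- Vertex set of the square HH: all vertices of the first copy, plus the
-- unlabeled vertices of the second copy (labeled ones are identified).
SqV : PLGraph → Set
SqV P = Fin (n (H P)) ⊎ Σ (Fin (n (H P))) (λ v → ¬ Labeled P v)

SqAdj : (P : PLGraph) → SqV P → SqV P → Set
SqAdj P (inj₁ u)       (inj₁ v)       = T (adj (H P) u v)
SqAdj P (inj₂ (u , _)) (inj₂ (v , _)) = T (adj (H P) u v)
SqAdj P (inj₁ u)       (inj₂ (v , _)) = Labeled P u × T (adj (H P) u v)
SqAdj P (inj₂ (u , _)) (inj₁ v)       = Labeled P v × T (adj (H P) u v)

IsSquare : Graph → Set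
IsSquare G = ∃ λ (P : PLGraph) → Σ (Fin (n G) → SqV P) λ f →
  Bijective _≡_ _≡_ f × (∀ x y → (T (adj G x y) ⇔ SqAdj P (f x) (f y)))

K-adj : ∀ {m} → Fin m → Fin m → Bool
K-adj i j = not ⌊ i ≟ j ⌋

K-sym : ∀ {m} (i j : Fin m) → K-adj i j ≡ K-adj j i
K-sym i j with i ≟ j | j ≟ i
... | yes _ | yes _ = refl
... | no _  | no _  = refl
... | yes p | no q  with q (sym p)
... | ()
K-sym i j | no p | yes q with p (sym q)
... | ()

K-irrefl : ∀ {m} (i : Fin m) → K-adj i i ≡ false
K-irrefl i with i ≟ i
... | yes _ = refl
... | no p with p refl
... | ()

K : ℕ → Graph
K m = record { n = m ; adj = K-adj ; adj-sym = K-sym ; adj-irrefl = K-irrefl }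

{-# OPTIONS --safe #-}
module Submission where

-- An unlabeled vertex v of H occurs twice in HH, once in each copy, and the two
-- occurrences are not adjacent: every edge between the copies has a labeled
-- endpoint. So every square has two distinct non-adjacent vertices, which K m
-- does not.

open import Defs
open import Data.Nat using (ℕ; _≤_)
open import Data.Fin using (Fin; _≟_)
open import Data.Bool using (T)
open import Data.Unit using (tt)
open import Data.Product using (∃₂; _×_; _,_; proj₁; proj₂)
open import Data.Sum using (inj₁; inj₂)
open import Function.Bundles using (Equivalence)
open import Relation.Nullary using (¬_; yes; no)
open import Relation.Binary.PropositionalEquality using (_≡_; _≢_; refl; sym; trans; cong; subst₂)

HasNonEdge : Graph → Set
HasNonEdge G = ∃₂ λ x y → x ≢ y × ¬ T (adj G x y)

K-adj-≢ : ∀ {m} {x y : Fin m} → x ≢ y → T (K-adj x y)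
K-adj-≢ {x = x} {y} x≢y with x ≟ y
... | yes x≡y = x≢y x≡y
... | no _    = tt

K-complete : ∀ m → ¬ HasNonEdge (K m)
K-complete m (x , y , x≢y , ¬xy) = ¬xy (K-adj-≢ x≢y)

copies-nonadjacent : ∀ P {v} (unlabeled : ¬ Labeled P v) →
                     ¬ SqAdj P (inj₁ v) (inj₂ (v , unlabeled))
copies-nonadjacent P unlabeled (labeled , _) = unlabeled labeled

square-hasNonEdge : ∀ {G} → IsSquare G → HasNonEdge G
square-hasNonEdge {G} (P , f , (_ , surj) , iso) with proper P
... | v , notImage = x , y , x≢y , ¬xy
  where
  unlabeled : ¬ Labeled P v
  unlabeled (ℓ , θℓ≡v) = notImage ℓ θℓ≡v

  x y : Fin (n G)
  x = proj₁ (surj (inj₁ v))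
  y = proj₁ (surj (inj₂ (v , unlabeled)))

  fx : f x ≡ inj₁ v
  fx = proj₂ (surj (inj₁ v)) refl

  fy : f y ≡ inj₂ (v , unlabeled)
  fy = proj₂ (surj (inj₂ (v , unlabeled))) refl

  x≢y : x ≢ y
  x≢y x≡y with trans (sym fx) (trans (cong f x≡y) fy)
  ... | ()

  ¬xy : ¬ T (adj G x y)
  ¬xy xy = copies-nonadjacent P unlabeled
             (subst₂ (SqAdj P) fx fy (Equivalence.to (iso x y) xy))

proposition4p3 : ∀ (m : ℕ) → 1 ≤ m → ¬ IsSquare (K m)
proposition4p3 m _ square = K-complete m (square-hasNonEdge {K m} square)
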